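{- For every path $\rho$, $\rho$ has no subpath that is an lb-corner if and only if $\rho$ has no subpath that is a long corner.
   Context: Let $R(\mathbf{x},\mathbf{x}')$ be a difference bounds constraint over $\mathbf{x}=\{x_1,\dots,x_N\}$ (a finite conjunction of atoms $u-v\le c$, $c\in\mathbb{Z}$, with constraint graph having an edge $u\xrightarrow{c}v$ per atom). With fresh copies $x_i^{(p)}$, $p\in\mathbb{Z}$ (position $p$), the bi-infinite unfolding is the union over all $p$ of the constraint graphs of $R(\mathbf{x}^{(p)},\mathbf{x}^{(p+1)})$; all paths are in it, subpaths are contiguous. A corner is a path $x_{i_0}^{(k_0)}\to\cdots\to x_{i_m}^{(k_m)}$, $m\ge1$, with $k_0=k_m$; it is a right (left) corner of extent $d$ if its positions are $\{k_0,\dots,k_0+d\}$ ($\{k_0-d,\dots,k_0\}$); basic if $k_0\notin\{k_1,\dots,k_{m-1}\}$; long if $d>N^2$; an lb-corner if long and basic. -}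

module Defs where

open import Data.Nat using (ℕ) renaming (_*_ to _*ℕ_; _<_ to _<ℕ_)
open import Data.Integer using (ℤ; +_; _+_; _-_; _≤_)
open import Data.Fin using (Fin)
open import Data.Bool using (Bool; true; false)
open import Data.List using (List; []; _∷_; _++_; map)
open import Data.List.Membership.Propositional using (_∈_)
open import Data.List.Relation.Unary.All using (All)
open import Data.List.Relation.Unary.Linked using (Linked)
open import Data.Product using (Σ; _×_; _,_; proj₁; proj₂)
open import Data.Sum using (_⊎_)
open import Relation.Binary.PropositionalEquality using (_≡_; _≢_)
open import Function.Bundles using (_⇔_)

-- Variables of R(x, x'): x_i (unprimed) or x'_i (primed).
data Var (N : ℕ) : Set where
  unp : Fin N → Var N
  pri : Fin N → Var N

-- An atom  u - v ≤ c ; its constraint-graph edge is u --c--> v.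
record Atom (N : ℕ) : Set where
  constructor _-_≤'_
  field
    left  : Var N
    right : Var N
    bound : ℤ

DBC : ℕ → Set
DBC N = List (Atom N)

-- Vertices of the bi-infinite unfolding: x_i^(p)  ↦  (i , p).
Vertex : ℕ → Set
Vertex N = Fin N × ℤ

pos : ∀ {N} → Vertex N → ℤ
pos = proj₂

-- Instantiating R(x^(k), x^(k+1)).
inst : ∀ {N} → ℤ → Var N → Vertex N
inst k (unp i) = i , k
inst k (pri i) = i , k + + 1

Edge : ∀ {N} → DBC N → Vertex N → Vertex N → Set
Edge {N} R v w =
  Σ (Atom N) λ a → a ∈ R × Σ ℤ λ k →
    inst k (Atom.left a) ≡ v × inst k (Atom.right a) ≡ w

NonEmpty : ∀ {A : Set} → List A → Set
NonEmpty xs = xs ≢ []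

Path : ∀ {N} → DBC N → Set
Path {N} R = Σ (List (Vertex N)) λ vs → NonEmpty vs × Linked (Edge R) vs

verts : ∀ {N} {R : DBC N} → Path R → List (Vertex N)
verts = proj₁

Subpath : ∀ {N} {R : DBC N} → Path R → Path R → Set
Subpath {N} σ ρ = Σ (List (Vertex N)) λ pre → Σ (List (Vertex N)) λ suf →
  verts ρ ≡ pre ++ (verts σ ++ suf)

CornerShape : ∀ {N} → List (Vertex N) → Vertex N → List (Vertex N) → Vertex N → Set
CornerShape vs a mid b = vs ≡ a ∷ (mid ++ b ∷ []) × pos a ≡ pos b

Corner : ∀ {N} → List (Vertex N) → Set
Corner {N} vs = Σ (Vertex N) λ a → Σ (List (Vertex N)) λ mid → Σ (Vertex N) λ b →
  CornerShape vs a mid b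

RightCorner : ∀ {N} → ℕ → List (Vertex N) → Set
RightCorner {N} d vs = Σ (Vertex N) λ a → Σ (List (Vertex N)) λ mid → Σ (Vertex N) λ b →
  CornerShape vs a mid b ×
  (∀ (p : ℤ) → (p ∈ map pos vs) ⇔ (pos a ≤ p × p ≤ pos a + + d))

LeftCorner : ∀ {N} → ℕ → List (Vertex N) → Set
LeftCorner {N} d vs = Σ (Vertex N) λ a → Σ (List (Vertex N)) λ mid → Σ (Vertex N) λ b →
  CornerShape vs a mid b ×
  (∀ (p : ℤ) → (p ∈ map pos vs) ⇔ (pos a - + d ≤ p × p ≤ pos a))

BasicCorner : ∀ {N} → List (Vertex N) → Set
BasicCorner {N} vs = Σ (Vertex N) λ a → Σ (List (Vertex N)) λ mid → Σ (Vertex N) λ b →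
  CornerShape vs a mid b × All (λ w → pos w ≢ pos a) mid

LongCorner : ∀ {N} → List (Vertex N) → Set
LongCorner {N} vs = Σ ℕ λ d → (N *ℕ N) <ℕ d × (RightCorner d vs ⊎ LeftCorner d vs)

LBCorner : ∀ {N} → List (Vertex N) → Set
LBCorner vs = LongCorner vs × BasicCorner vs

HasSubpathWith : ∀ {N} {R : DBC N} → (List (Vertex N) → Set) → Path R → Set
HasSubpathWith {N} {R} P ρ = Σ (Path R) λ σ → Subpath σ ρ × P (verts σ)

module Submission where

-- Every lb-corner is long, so only "long corner ⇒ lb-corner" needs an
-- argument.  Let σ be a right corner of extent d at position k (left
-- corners are symmetric) and c a vertex of σ at the far position k + d.
-- Cutting σ at its vertices of position k yields basic corners; let τ be
-- the piece through c.  The positions of τ are among those of σ, so lie in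
-- [k , k + d]; and since along an edge the position moves by at most one,
-- τ meets every position between its start k and k + d (a discrete
-- intermediate value theorem).  So τ is a basic right corner of extent d.

open import Defs
open import Data.Nat using (ℕ)
open import Relation.Nullary using (¬_; yes; no; contradiction)
open import Function.Bundles using (_⇔_; mk⇔; Equivalence)

open import Data.Integer using (ℤ; +_; _+_; _-_; _≤_; suc)
open import Data.Integer.Properties
  using (_≟_; ≤-refl; ≤-trans; ≤-reflexive; ≤-antisym; ≤∧≢⇒<; <-≤-trans; <-irrefl;
         ≮⇒≥; i<j⇒suc[i]≤j; suc-mono; i≤suc[i]; i≤i+j; i-j≤i; +-comm)
open import Data.List using (List; []; _∷_; _++_; map)
open import Data.List.Properties using (++-assoc; ++-identityʳ)
open import Data.List.Membership.Propositional using (_∈_)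
open import Data.List.Membership.Propositional.Properties
  using (∈-++⁺ˡ; ∈-++⁺ʳ; ∈-++⁻; ∈-map⁺; ∈-map⁻)
open import Data.List.Relation.Unary.Any using (here; there)
open import Data.List.Relation.Unary.All using (All; []; _∷_)
import Data.List.Relation.Unary.All as All
open import Data.List.Relation.Unary.All.Properties using (++⁺)
open import Data.List.Relation.Unary.Linked using (Linked; []; [-]; _∷_)
import Data.List.Relation.Unary.Linked as Linked
import Data.List.Relation.Unary.Linked.Properties as Linked
open import Data.Product using (Σ; _×_; _,_)
open import Data.Sum using (_⊎_; inj₁; inj₂)
open import Relation.Unary using (Decidable)
open import Relation.Binary.PropositionalEquality
  using (_≡_; _≢_; refl; sym; trans; cong; subst; module ≡-Reasoning)
open import Function using (_∘_)

Near : ℤ → ℤ → Set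
Near x y = y ≤ suc x × x ≤ suc y

Between : ℤ → ℤ → ℤ → Set
Between x t p = (x ≤ p × p ≤ t) ⊎ (t ≤ p × p ≤ x)

between-self : ∀ {x p} → Between x x p → p ≡ x
between-self (inj₁ (x≤p , p≤x)) = ≤-antisym p≤x x≤p
between-self (inj₂ (x≤p , p≤x)) = ≤-antisym p≤x x≤p

between-step : ∀ {x y t p} → Near x y → p ≢ x → Between x t p → Between y t p
between-step (y≤1+x , _) p≢x (inj₁ (x≤p , p≤t)) =
  inj₁ (≤-trans y≤1+x (i<j⇒suc[i]≤j (≤∧≢⇒< x≤p (p≢x ∘ sym))) , p≤t)
between-step {p = p} (_ , x≤1+y) p≢x (inj₂ (t≤p , p≤x)) = inj₂ (t≤p , p≤y)
  where
  p<x = ≤∧≢⇒< p≤x p≢x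
  p≤y = ≮⇒≥ (λ y<p → <-irrefl {p} refl
                        (<-≤-trans p<x (≤-trans x≤1+y (i<j⇒suc[i]≤j y<p))))

ivt : ∀ {x xs t p} → Linked Near (x ∷ xs) → t ∈ x ∷ xs → Between x t p → p ∈ x ∷ xs
ivt {x} {p = p} steps t∈ btw with p ≟ x
... | yes p≡x = here p≡x
ivt _              (here refl) btw | no p≢x = contradiction (between-self btw) p≢x
ivt [-]            (there ())  _   | no _
ivt (near ∷ steps) (there t∈)  btw | no p≢x = there (ivt steps t∈ (between-step near p≢x btw))

Infix : ∀ {A : Set} → List A → List A → Set
Infix {A} seg xs = Σ (List A) λ pre → Σ (List A) λ suf → xs ≡ pre ++ (seg ++ suf)

module _ {A : Set} where

  infix-trans : {xs ys zs : List A} → Infix xs ys → Infix ys zs → Infix xs zs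
  infix-trans {xs} {ys} {zs} (pre , suf , ys≡) (pre′ , suf′ , zs≡) =
    pre′ ++ pre , suf ++ suf′ , (begin
      zs                                      ≡⟨ zs≡ ⟩
      pre′ ++ (ys ++ suf′)                     ≡⟨ cong (λ l → pre′ ++ (l ++ suf′)) ys≡ ⟩
      pre′ ++ ((pre ++ (xs ++ suf)) ++ suf′)   ≡⟨ cong (pre′ ++_) (++-assoc pre (xs ++ suf) suf′) ⟩
      pre′ ++ (pre ++ ((xs ++ suf) ++ suf′))   ≡⟨ cong (λ l → pre′ ++ (pre ++ l)) (++-assoc xs suf suf′) ⟩
      pre′ ++ (pre ++ (xs ++ (suf ++ suf′)))   ≡⟨ ++-assoc pre′ pre _ ⟨
      (pre′ ++ pre) ++ (xs ++ (suf ++ suf′))   ∎)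
    where open ≡-Reasoning

  infix-suffix : (pre xs : List A) → Infix xs (pre ++ xs)
  infix-suffix pre xs = pre , [] , cong (pre ++_) (sym (++-identityʳ xs))

  infix-∈ : {x : A} {seg xs : List A} → Infix seg xs → x ∈ seg → x ∈ xs
  infix-∈ (pre , suf , refl) x∈ = ∈-++⁺ʳ pre (∈-++⁺ˡ x∈)

  infix-∈-map : {B : Set} (f : A → B) {y : B} {seg xs : List A} →
                Infix seg xs → y ∈ map f seg → y ∈ map f xs
  infix-∈-map f seg⊑xs y∈ with x , x∈ , refl ← ∈-map⁻ f y∈ = ∈-map⁺ f (infix-∈ seg⊑xs x∈)

  linked-infix : {R : A → A → Set} {seg xs : List A} → Infix seg xs → Linked R xs → Linked R seg
  linked-infix {R} {seg} (pre , suf , refl) = prefix seg ∘ suffix pre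
    where
    suffix : ∀ pre {ys} → Linked R (pre ++ ys) → Linked R ys
    suffix []        l = l
    suffix (_ ∷ pre) l = suffix pre (Linked.tail l)
    prefix : ∀ xs {ys} → Linked R (xs ++ ys) → Linked R xs
    prefix []           _       = []
    prefix (_ ∷ [])     _       = [-]
    prefix (_ ∷ y ∷ xs) (r ∷ l) = r ∷ prefix (y ∷ xs) l

module Blocks {A : Set} {P : A → Set} (P? : Decidable P) where

  Block : List A → Set
  Block seg = Σ A λ a → Σ (List A) λ m → Σ A λ b →
    seg ≡ a ∷ (m ++ b ∷ []) × P a × P b × All (¬_ ∘ P) m

  BlockAround : A → List A → Set
  BlockAround c xs = Σ (List A) λ seg → Infix seg xs × Block seg × c ∈ seg

  private
    extend : ∀ pre {c xs} → BlockAround c xs → BlockAround c (pre ++ xs)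
    extend pre {xs = xs} (seg , seg⊑ , blk , c∈) =
      seg , infix-trans seg⊑ (infix-suffix pre xs) , blk , c∈

    regroup : ∀ (a : A) acc y rest → a ∷ (acc ++ y ∷ rest) ≡ (a ∷ (acc ++ y ∷ [])) ++ rest
    regroup a acc y rest = cong (a ∷_) (sym (++-assoc acc (y ∷ []) rest))

    -- Scan rightwards from the P-element a, having already passed the
    -- non-P elements acc; the list is known to end with a P-element b.
    scan : ∀ {c} a acc rest b → P a → All (¬_ ∘ P) acc → P b →
           c ∈ a ∷ (acc ++ rest ++ b ∷ []) → BlockAround c (a ∷ (acc ++ rest ++ b ∷ []))
    scan a acc [] b pa ¬acc pb c∈ =
      _ , ([] , [] , sym (++-identityʳ _)) , (a , acc , b , refl , pa , pb , ¬acc) , c∈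
    scan {c} a acc (y ∷ rest) b pa ¬acc pb c∈ with P? y
    ... | yes py with ∈-++⁻ (a ∷ (acc ++ y ∷ [])) (subst (c ∈_) (regroup a acc y _) c∈)
    ...   | inj₁ c∈blk =
      _ , ([] , rest ++ b ∷ [] , regroup a acc y _) , (a , acc , y , refl , pa , py , ¬acc) , c∈blk
    ...   | inj₂ c∈rest = extend (a ∷ acc) (scan y [] rest b py [] pb (there c∈rest))
    scan {c} a acc (y ∷ rest) b pa ¬acc pb c∈ | no ¬py =
      subst (BlockAround c) (sym (regroup a acc y _))
        (scan a (acc ++ y ∷ []) rest b pa (++⁺ ¬acc (¬py ∷ [])) pb
          (subst (c ∈_) (regroup a acc y _) c∈))

  block-around : ∀ {c} a mid b → P a → P b →
                 c ∈ a ∷ (mid ++ b ∷ []) → BlockAround c (a ∷ (mid ++ b ∷ []))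
  block-around a mid b pa pb = scan a [] mid b pa [] pb

-- The position set of vs is the "interval" I k anchored at the position
-- k of its endpoints.  Right and left corners of extent d are instances.
IntervalCorner : ∀ {N} → (ℤ → ℤ → Set) → List (Vertex N) → Set
IntervalCorner {N} I vs = Σ (Vertex N) λ a → Σ (List (Vertex N)) λ mid → Σ (Vertex N) λ b →
  CornerShape vs a mid b × (∀ p → (p ∈ map pos vs) ⇔ I (pos a) p)

record Anchored (I : ℤ → ℤ → Set) : Set where
  field
    far     : ℤ → ℤ
    far∈    : ∀ k → I k (far k)
    between : ∀ {k p} → I k p → Between k (far k) p

rightward : ∀ d → Anchored (λ k p → k ≤ p × p ≤ k + + d)
rightward d = record
  { far = λ k → k + + d ; far∈ = λ k → i≤i+j k (+ d) , ≤-refl ; between = inj₁ }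

leftward : ∀ d → Anchored (λ k p → k - + d ≤ p × p ≤ k)
leftward d = record
  { far = λ k → k - + d ; far∈ = λ k → ≤-refl , i-j≤i k (+ d) ; between = inj₂ }

module _ {N : ℕ} {R : DBC N} where

  inst-pos : ∀ k (u : Var N) → k ≤ pos (inst k u) × pos (inst k u) ≤ suc k
  inst-pos k (unp i) = ≤-refl , i≤suc[i] k
  inst-pos k (pri i) = i≤i+j k (+ 1) , ≤-reflexive (+-comm k (+ 1))

  edge-near : ∀ {v w} → Edge R v w → Near (pos v) (pos w)
  edge-near (a , _ , k , refl , refl) =
    unit-window (inst-pos k (Atom.left a)) (inst-pos k (Atom.right a))
    where
    unit-window : ∀ {x y} → k ≤ x × x ≤ suc k → k ≤ y × y ≤ suc k → Near x y
    unit-window (k≤x , x≤1+k) (k≤y , y≤1+k) =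
      ≤-trans y≤1+k (suc-mono k≤x) , ≤-trans x≤1+k (suc-mono k≤y)

  positions-near : (σ : Path R) → Linked Near (map pos (verts σ))
  positions-near (_ , _ , edges) = Linked.map⁺ (Linked.map edge-near edges)

  open Blocks

  -- A corner whose positions form an anchored interval contains, as a
  -- subpath, a basic corner with the same interval of positions: the
  -- basic piece through a vertex at the far end.
  basic-narrowing : ∀ {I} → Anchored I → (σ : Path R) → IntervalCorner I (verts σ) →
    Σ (Path R) λ τ → Subpath τ σ × IntervalCorner I (verts τ) × BasicCorner (verts τ)
  basic-narrowing {I} A (_ , _ , edges) (a , mid , b , (refl , pa≡pb) , iff)
    with c , c∈ , far≡pc ← ∈-map⁻ pos (Equivalence.from (iff _) (Anchored.far∈ A (pos a)))
    with _ , τ⊑σ , (a′ , mid′ , b′ , refl , pa′ , pb′ , ¬mid′) , c∈τ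
           ← block-around (λ w → pos w ≟ pos a) a mid b refl (sym pa≡pb) c∈
    = τ , τ⊑σ , (a′ , mid′ , b′ , shape , iff′) , (a′ , mid′ , b′ , shape , basic)
    where
    open Anchored A
    k = pos a
    τ : Path R
    τ = a′ ∷ (mid′ ++ b′ ∷ []) , (λ ()) , linked-infix τ⊑σ edges
    shape : CornerShape (verts τ) a′ mid′ b′
    shape = refl , trans pa′ (sym pb′)
    basic : All (λ w → pos w ≢ pos a′) mid′
    basic = All.map (λ ¬p≡k p≡a′ → ¬p≡k (trans p≡a′ pa′)) ¬mid′
    far∈τ : far k ∈ map pos (verts τ)
    far∈τ = subst (_∈ _) (sym far≡pc) (∈-map⁺ pos c∈τ)
    iff′ : ∀ p → (p ∈ map pos (verts τ)) ⇔ I (pos a′) p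
    iff′ p = mk⇔
      (λ p∈τ → subst (λ x → I x p) (sym pa′) (Equivalence.to (iff p) (infix-∈-map pos τ⊑σ p∈τ)))
      (λ p∈I → ivt (positions-near τ) far∈τ
                 (subst (λ x → Between x (far k) p) (sym pa′)
                   (between (subst (λ x → I x p) pa′ p∈I))))

  long⇒lb : (ρ : Path R) → HasSubpathWith LongCorner ρ → HasSubpathWith LBCorner ρ
  long⇒lb ρ (σ , σ⊑ρ , d , N²<d , inj₁ right)
    with τ , τ⊑σ , right′ , basic ← basic-narrowing (rightward d) σ right
    = τ , infix-trans τ⊑σ σ⊑ρ , (d , N²<d , inj₁ right′) , basic
  long⇒lb ρ (σ , σ⊑ρ , d , N²<d , inj₂ left)
    with τ , τ⊑σ , left′ , basic ← basic-narrowing (leftward d) σ left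
    = τ , infix-trans τ⊑σ σ⊑ρ , (d , N²<d , inj₂ left′) , basic

proposition12 : (N : ℕ) (R : DBC N) (ρ : Path R) →
    (¬ HasSubpathWith LBCorner ρ) ⇔ (¬ HasSubpathWith LongCorner ρ)
proposition12 N R ρ = mk⇔
  (λ no-lb long → no-lb (long⇒lb ρ long))
  (λ no-long (σ , σ⊑ρ , long , _) → no-long (σ , σ⊑ρ , long))
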